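{- Let $n\ge1$, $r\in[n]$ and $m$ an integer with $m\ge r$. Then $$\sum_{0\le s\le n-r}{}^{r}\!A_{n,n-r-s}\binom{m+s}{n}=m^{n-r}\,\frac{m!}{(m-r)!}.$$
   Context: $\mathfrak S_n$ is the symmetric group on $[n]=\{1,\dots,n\}$. ${}^{r}\!A_n(t)=\sum_{\sigma\in\mathfrak S_n}t^{|\{k\in[n]:\sigma(k)\ge k+r\}|}$, a polynomial of degree at most $n-r$, and ${}^{r}\!A_{n,k}$ denotes its coefficient of $t^k$, so ${}^{r}\!A_{n,k}$ is the number of $\sigma\in\mathfrak S_n$ with exactly $k$ indices $j$ such that $\sigma(j)\ge j+r$. -}

module Defs where

open import Data.Nat using (ℕ; zero; suc; _+_; _≤?_)
open import Data.Fin using (Fin; toℕ)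
open import Data.Fin.Properties using (_≟_; all?)
open import Data.Vec using (Vec; []; _∷_; lookup; toList)
open import Data.List using (List; []; _∷_; concatMap; map; length; filter; allFin)
open import Data.List.Relation.Unary.AllPairs using (AllPairs)
import Data.List.Relation.Unary.AllPairs as AllPairs
open import Relation.Nullary using (¬_; Dec)
open import Relation.Nullary using (¬?)
open import Relation.Binary.PropositionalEquality using (_≡_)
open import Data.Nat.Properties using () renaming (_≟_ to _≟ℕ_)
open import Data.Fin.Subset using (Subset; ∣_∣)
open import Data.Vec using (tabulate)
open import Data.Bool using (Bool; true; false)
open import Relation.Nullary using (does)

vecsOver : {A : Set} → List A → (k : ℕ) → List (Vec A k)
vecsOver xs zero    = [] ∷ []
vecsOver xs (suc k) = concatMap (λ x → map (x ∷_) (vecsOver xs k)) xs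

-- all functions [n] → [n], as vectors of images (σ(i) = lookup σ i)
allMaps : (n : ℕ) → List (Vec (Fin n) n)
allMaps n = vecsOver (allFin n) n

-- σ is a permutation iff its values are pairwise distinct (injective on a finite set)
IsPerm : {n : ℕ} → Vec (Fin n) n → Set
IsPerm σ = AllPairs (λ x y → ¬ (x ≡ y)) (toList σ)

isPerm? : {n : ℕ} (σ : Vec (Fin n) n) → Dec (IsPerm σ)
isPerm? σ = AllPairs.allPairs? (λ x y → ¬? (x ≟ y)) (toList σ)

perms : (n : ℕ) → List (Vec (Fin n) n)
perms n = filter isPerm? (allMaps n)

-- the set { k ∈ [n] : σ(k) ≥ k + r }  (0-based indices; shift cancels)
rExc : {n : ℕ} → ℕ → Vec (Fin n) n → Subset n
rExc r σ = tabulate (λ i → does ((toℕ i + r) ≤? toℕ (lookup σ i)))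

rA : (r n k : ℕ) → ℕ
rA r n k = length (filter (λ σ → ∣ rExc r σ ∣ ≟ℕ k) (perms n))

sumTo : ℕ → (ℕ → ℕ) → ℕ
sumTo zero    f = f 0
sumTo (suc N) f = sumTo N f + f (suc N)

{-# OPTIONS --safe #-}
module Submission where

-- Write e(σ) for the number of r-excedances of σ, positions and values counted from 0.  Since
-- e(σ) ≤ n - r, the left-hand side regroups as the sum over σ ∈ 𝔖_n of C(x + n - e(σ), n) with
-- x = m - r.  By induction on n this sum is ∏_{i=1..n} (x + min(r, i)): every permutation of
-- {0,…,n} is uniquely (τ extended by the fixed point n) ∘ (q n) with τ ∈ 𝔖_n and q ≤ n, and it
-- has e(τ) + [q + r ≤ n] - [q + r ≤ τ(q)] r-excedances (reading τ(n) = n).  Summing over q with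
-- Pascal's rule and the absorption identity (n+1) C(N+1, n+1) = (N+1) C(N, n) leaves the factor
-- x + min(r, n+1) times C(x + n - e(τ), n).  For n ≥ r the product is (x + r)^(n-r) (x + r)!/x!.

open import Defs
open import Data.Bool using (Bool; true; false)
open import Data.Fin as Fin using (Fin; toℕ; fromℕ; inject₁; lower₁)
open import Data.Fin.Permutation.Components using (transpose; transpose-inverse)
import Data.Fin.Properties as Finₚ
open import Data.Fin.Relation.Unary.Top using (view; ‵fromℕ; ‵inj₁)
open import Data.Fin.Subset using (∣_∣)
open import Data.List as List using (List; []; _∷_; map; filter; length; concatMap)
open import Data.List.Membership.Propositional using (_∈_)
open import Data.List.Membership.Propositional.Properties
  using (∈-concat⁺′; ∈-concat⁻′; ∈-map⁺; ∈-map⁻; ∈-filter⁺; ∈-filter⁻; ∈-allFin;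
         ∈-tabulate⁺; ∈-tabulate⁻)
open import Data.List.Membership.Propositional.Properties.WithK using (unique∧set⇒bag)
import Data.List.Properties as Listₚ
open import Data.List.Relation.Binary.BagAndSetEquality using (∼bag⇒↭)
open import Data.List.Relation.Binary.Disjoint.Propositional using (Disjoint)
open import Data.List.Relation.Binary.Permutation.Propositional using (_↭_)
import Data.List.Relation.Binary.Permutation.Propositional.Properties as ↭ₚ
import Data.List.Relation.Unary.All as All
import Data.List.Relation.Unary.All.Properties as Allₚ
open import Data.List.Relation.Unary.Any using (here)
import Data.List.Relation.Unary.AllPairs as AllPairs
import Data.List.Relation.Unary.AllPairs.Properties as AllPairsₚ
open import Data.List.Relation.Unary.Unique.Propositional using (Unique; []; _∷_)
import Data.List.Relation.Unary.Unique.Propositional.Properties as Uniqueₚ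
open import Data.Nat using (ℕ; zero; suc; _+_; _*_; _∸_; _^_; _≤_; _<_; _/_; _⊓_; z≤n; s≤s; s≤s⁻¹; _!)
open import Data.Nat.Combinatorics using (_C_; nC1≡n; nCk+nC[k+1]≡[n+1]C[k+1])
open import Data.Nat.DivMod using (m*n/n≡m)
open import Data.Nat.ListAction using (sum)
open import Data.Nat.ListAction.Properties using (sum-++; sum-↭)
open import Data.Nat.Properties
open import Data.Nat.Properties using () renaming (_≟_ to _≟ℕ_)
open import Algebra.Properties.CommutativeSemigroup +-commutativeSemigroup using (interchange)
open import Algebra.Properties.Semiring.Sum +-*-semiring
  using (sum-syntax; sum-cong-≗; sum-init-last; sum-remove; ∑-distrib-+; *-distribʳ-sum)
  renaming (sum to ∑)
open import Data.Nat.Tactic.RingSolver using (solve-∀)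
open import Data.Product using (∃; ∃₂; _×_; _,_; proj₁; proj₂)
open import Data.Vec as Vec using (Vec; tabulate; lookup; toList; _∷ʳ_)
open import Data.Vec.Functional using (removeAt)
import Data.Vec.Properties as Vecₚ
open import Function using (_∘_)
open import Function.Bundles using (mk⇔)
open import Function.Definitions using (Injective)
open import Relation.Binary.PropositionalEquality
open import Relation.Nullary using (Dec; does; yes; no; contradiction)
open import Relation.Nullary.Decidable using (dec-true; dec-false; does-⇔)
open import Relation.Unary using (Decidable)

𝟙 : Bool → ℕ
𝟙 true  = 1
𝟙 false = 0

⟦_≤_⟧ : ℕ → ℕ → ℕ
⟦ a ≤ b ⟧ = 𝟙 (does (a ≤? b))

⟦⟧-yes : ∀ {a b} → a ≤ b → ⟦ a ≤ b ⟧ ≡ 1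
⟦⟧-yes {a} {b} a≤b = cong 𝟙 (dec-true (a ≤? b) a≤b)

⟦⟧-no : ∀ {a b} → b < a → ⟦ a ≤ b ⟧ ≡ 0
⟦⟧-no {a} {b} b<a = cong 𝟙 (dec-false (a ≤? b) (<⇒≱ b<a))

⟦⟧≤1 : ∀ a b → ⟦ a ≤ b ⟧ ≤ 1
⟦⟧≤1 a b with does (a ≤? b)
... | true  = ≤-refl
... | false = z≤n

⟦⟧-mono : ∀ {a b c d} → (a ≤ b → c ≤ d) → ⟦ a ≤ b ⟧ ≤ ⟦ c ≤ d ⟧
⟦⟧-mono {a} {b} a≤b⇒c≤d with a ≤? b
... | yes a≤b = ≤-reflexive (trans (⟦⟧-yes a≤b) (sym (⟦⟧-yes (a≤b⇒c≤d a≤b))))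
... | no  a≰b = ≤-trans (≤-reflexive (⟦⟧-no (≰⇒> a≰b))) z≤n

⟦⟧-cong-suc : ∀ a b → ⟦ suc a ≤ suc b ⟧ ≡ ⟦ a ≤ b ⟧
⟦⟧-cong-suc a b = cong 𝟙 (does-⇔ (mk⇔ s≤s⁻¹ s≤s) (suc a ≤? suc b) (a ≤? b))

∣tabulate∣≡∑ : ∀ {n} (p : Fin n → Bool) → ∣ tabulate p ∣ ≡ ∑[ i < n ] 𝟙 (p i)
∣tabulate∣≡∑ {zero}  p = refl
∣tabulate∣≡∑ {suc n} p with p Fin.zero
... | true  = cong suc (∣tabulate∣≡∑ (p ∘ Fin.suc))
... | false = ∣tabulate∣≡∑ (p ∘ Fin.suc)

∑-cong : ∀ {n} {f g : Fin n → ℕ} → (∀ i → f i ≡ g i) → ∑ f ≡ ∑ g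
∑-cong = sum-cong-≗

∑-const : ∀ n c → ∑[ i < n ] c ≡ n * c
∑-const zero    c = refl
∑-const (suc n) c = cong (c +_) (∑-const n c)

∑-mono-≤ : ∀ {n} {f g : Fin n → ℕ} → (∀ i → f i ≤ g i) → ∑ f ≤ ∑ g
∑-mono-≤ {zero}  f≤g = z≤n
∑-mono-≤ {suc n} f≤g = +-mono-≤ (f≤g Fin.zero) (∑-mono-≤ (f≤g ∘ Fin.suc))

∑-update : ∀ {n} (f g : Fin (suc n) → ℕ) q → (∀ i → i ≢ q → f i ≡ g i) → ∑ f + g q ≡ ∑ g + f q
∑-update f g q f≗g = begin
  ∑ f + g q                     ≡⟨ cong (_+ g q) (sum-remove {i = q} f) ⟩
  f q + ∑ (removeAt f q) + g q  ≡⟨ cong (λ s → f q + s + g q) (∑-cong removed-≗) ⟩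
  f q + rest + g q              ≡⟨ swap-outer (f q) rest (g q) ⟩
  g q + rest + f q              ≡⟨ cong (_+ f q) (sum-remove {i = q} g) ⟨
  ∑ g + f q                     ∎
  where
  open ≡-Reasoning
  rest = ∑ (removeAt g q)
  removed-≗ : ∀ k → removeAt f q k ≡ removeAt g q k
  removed-≗ k = f≗g _ (Finₚ.punchInᵢ≢i q k)
  swap-outer : ∀ a b c → a + b + c ≡ c + b + a
  swap-outer = solve-∀

∑[i<n]⟦i+t<n⟧≡n∸t : ∀ n t → ∑[ i < n ] ⟦ suc (toℕ i + t) ≤ n ⟧ ≡ n ∸ t
∑[i<n]⟦i+t<n⟧≡n∸t zero    t = sym (0∸n≡0 t)
∑[i<n]⟦i+t<n⟧≡n∸t (suc n) t = begin
  ⟦ suc t ≤ suc n ⟧ + ∑[ i < n ] ⟦ suc (suc (toℕ i + t)) ≤ suc n ⟧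
    ≡⟨ cong₂ _+_ (⟦⟧-cong-suc t n) (∑-cong {n} (λ i → ⟦⟧-cong-suc (suc (toℕ i + t)) n)) ⟩
  ⟦ t ≤ n ⟧ + ∑[ i < n ] ⟦ suc (toℕ i + t) ≤ n ⟧
    ≡⟨ cong (⟦ t ≤ n ⟧ +_) (∑[i<n]⟦i+t<n⟧≡n∸t n t) ⟩
  ⟦ t ≤ n ⟧ + (n ∸ t)
    ≡⟨ first-term (t ≤? n) ⟩
  suc n ∸ t ∎
  where
  open ≡-Reasoning
  first-term : Dec (t ≤ n) → ⟦ t ≤ n ⟧ + (n ∸ t) ≡ suc n ∸ t
  first-term (yes t≤n) = trans (cong (_+ (n ∸ t)) (⟦⟧-yes t≤n)) (sym (+-∸-assoc 1 t≤n))
  first-term (no  t≰n) = trans (cong₂ _+_ (⟦⟧-no n<t) (m≤n⇒m∸n≡0 (<⇒≤ n<t))) (sym (m≤n⇒m∸n≡0 n<t))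
    where n<t = ≰⇒> t≰n

sum-map-*ˡ : ∀ {A : Set} c (f : A → ℕ) xs → sum (map (λ a → c * f a) xs) ≡ c * sum (map f xs)
sum-map-*ˡ c f []       = sym (*-zeroʳ c)
sum-map-*ˡ c f (x ∷ xs) = trans (cong (c * f x +_) (sum-map-*ˡ c f xs)) (sym (*-distribˡ-+ c (f x) _))

sum-concatMap : ∀ {A B : Set} (g : B → ℕ) (f : A → List B) xs →
                sum (map g (concatMap f xs)) ≡ sum (map (λ x → sum (map g (f x))) xs)
sum-concatMap g f []       = refl
sum-concatMap g f (x ∷ xs) = begin
  sum (map g (f x List.++ concatMap f xs))                    ≡⟨ cong sum (Listₚ.map-++ g (f x) _) ⟩
  sum (map g (f x) List.++ map g (concatMap f xs))             ≡⟨ sum-++ (map g (f x)) _ ⟩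
  sum (map g (f x)) + sum (map g (concatMap f xs))             ≡⟨ cong (sum (map g (f x)) +_) (sum-concatMap g f xs) ⟩
  sum (map g (f x)) + sum (map (λ x → sum (map g (f x))) xs)   ∎
  where open ≡-Reasoning

sum-tabulate : ∀ {n} (f : Fin n → ℕ) → sum (List.tabulate f) ≡ ∑ f
sum-tabulate {zero}  f = refl
sum-tabulate {suc n} f = cong (f Fin.zero +_) (sum-tabulate (f ∘ Fin.suc))

length-filter-∷ : ∀ {A : Set} {P : A → Set} (P? : Decidable P) x xs →
                  length (filter P? (x ∷ xs)) ≡ 𝟙 (does (P? x)) + length (filter P? xs)
length-filter-∷ P? x xs with does (P? x)
... | true  = refl
... | false = refl

sumTo-cong : ∀ K {f g : ℕ → ℕ} → (∀ s → s ≤ K → f s ≡ g s) → sumTo K f ≡ sumTo K g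
sumTo-cong zero    f≗g = f≗g 0 z≤n
sumTo-cong (suc K) f≗g = cong₂ _+_ (sumTo-cong K (λ s → f≗g s ∘ m≤n⇒m≤1+n)) (f≗g (suc K) ≤-refl)

sumTo-distrib-+ : ∀ K (f g : ℕ → ℕ) → sumTo K (λ s → f s + g s) ≡ sumTo K f + sumTo K g
sumTo-distrib-+ zero    f g = refl
sumTo-distrib-+ (suc K) f g =
  trans (cong (_+ (f (suc K) + g (suc K))) (sumTo-distrib-+ K f g))
        (interchange (sumTo K f) (sumTo K g) (f (suc K)) (g (suc K)))

sumTo-zero : ∀ K → sumTo K (λ _ → 0) ≡ 0
sumTo-zero zero    = refl
sumTo-zero (suc K) = cong (_+ 0) (sumTo-zero K)

sumTo-indicator : ∀ K {j} (h : ℕ → ℕ) → j ≤ K → sumTo K (λ s → 𝟙 (does (s ≟ℕ j)) * h s) ≡ h j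
sumTo-indicator zero    h z≤n = +-identityʳ (h 0)
sumTo-indicator (suc K) {j} h j≤1+K with j ≟ℕ suc K
... | yes refl = begin
  sumTo K (λ s → 𝟙 (does (s ≟ℕ suc K)) * h s) + 𝟙 (does (suc K ≟ℕ suc K)) * h (suc K)
    ≡⟨ cong₂ _+_ (sumTo-cong K (λ s s≤K → cong (λ b → 𝟙 b * h s)
                                               (dec-false (s ≟ℕ suc K) (<⇒≢ (s≤s s≤K)))))
                 (cong (λ b → 𝟙 b * h (suc K)) (dec-true (suc K ≟ℕ suc K) refl)) ⟩
  sumTo K (λ _ → 0) + (h (suc K) + 0)
    ≡⟨ cong₂ _+_ (sumTo-zero K) (+-identityʳ (h (suc K))) ⟩
  h (suc K) ∎
  where open ≡-Reasoning
... | no j≢1+K = begin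
  sumTo K (λ s → 𝟙 (does (s ≟ℕ j)) * h s) + 𝟙 (does (suc K ≟ℕ j)) * h (suc K)
    ≡⟨ cong₂ _+_ (sumTo-indicator K h (s≤s⁻¹ (≤∧≢⇒< j≤1+K j≢1+K)))
                 (cong (λ b → 𝟙 b * h (suc K)) (dec-false (suc K ≟ℕ j) (j≢1+K ∘ sym))) ⟩
  h j + 0
    ≡⟨ +-identityʳ (h j) ⟩
  h j ∎
  where open ≡-Reasoning

sumTo-count : ∀ {A : Set} (xs : List A) (f : A → ℕ) K (h : ℕ → ℕ) → (∀ a → f a ≤ K) →
              sumTo K (λ s → length (filter (λ a → f a ≟ℕ K ∸ s) xs) * h s)
                ≡ sum (map (λ a → h (K ∸ f a)) xs)
sumTo-count []       f K h f≤K = sumTo-zero K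
sumTo-count (x ∷ xs) f K h f≤K = begin
  sumTo K (λ s → length (filter (P? s) (x ∷ xs)) * h s)
    ≡⟨ sumTo-cong K (λ s _ → trans (cong (_* h s) (length-filter-∷ (P? s) x xs))
                                   (*-distribʳ-+ (h s) (𝟙 (does (P? s x))) _)) ⟩
  sumTo K (λ s → 𝟙 (does (P? s x)) * h s + length (filter (P? s) xs) * h s)
    ≡⟨ sumTo-distrib-+ K _ _ ⟩
  sumTo K (λ s → 𝟙 (does (P? s x)) * h s) + sumTo K (λ s → length (filter (P? s) xs) * h s)
    ≡⟨ cong₂ _+_ (trans (sumTo-cong K (λ s s≤K → cong (λ b → 𝟙 b * h s) (flip-≟ s≤K)))
                        (sumTo-indicator K h (m∸n≤m K (f x))))
                 (sumTo-count xs f K h f≤K) ⟩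
  h (K ∸ f x) + sum (map (λ a → h (K ∸ f a)) xs) ∎
  where
  open ≡-Reasoning
  P? : (s : ℕ) → Decidable (λ a → f a ≡ K ∸ s)
  P? s a = f a ≟ℕ K ∸ s
  flip-≟ : ∀ {s} → s ≤ K → does (f x ≟ℕ K ∸ s) ≡ does (s ≟ℕ K ∸ f x)
  flip-≟ {s} s≤K = does-⇔ (mk⇔ (λ e → trans (sym (m∸[m∸n]≡n s≤K)) (cong (K ∸_) (sym e)))
                               (λ e → trans (sym (m∸[m∸n]≡n (f≤K x))) (cong (K ∸_) (sym e))))
                          (f x ≟ℕ K ∸ s) (s ≟ℕ K ∸ f x)

-- Binomial coefficients

[1+k]*[1+n]C[1+k]≡[1+n]*nCk : ∀ n k → suc k * (suc n C suc k) ≡ suc n * (n C k)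
[1+k]*[1+n]C[1+k]≡[1+n]*nCk zero    zero    = refl
[1+k]*[1+n]C[1+k]≡[1+n]*nCk zero    (suc k) = *-zeroʳ (2 + k)
[1+k]*[1+n]C[1+k]≡[1+n]*nCk (suc n) zero    =
  trans (+-identityʳ _) (trans (nC1≡n (2 + n)) (sym (*-identityʳ (2 + n))))
[1+k]*[1+n]C[1+k]≡[1+n]*nCk (suc n) (suc k) = begin
  (2 + k) * ((2 + n) C (2 + k))                     ≡⟨ cong ((2 + k) *_) (nCk+nC[k+1]≡[n+1]C[k+1] (suc n) (suc k)) ⟨
  (2 + k) * (a + b)                                 ≡⟨ expand k a b ⟩
  a + ((1 + k) * a + (2 + k) * b)                   ≡⟨ cong (a +_) (cong₂ _+_ ([1+k]*[1+n]C[1+k]≡[1+n]*nCk n k)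
                                                                           ([1+k]*[1+n]C[1+k]≡[1+n]*nCk n (suc k))) ⟩
  a + ((1 + n) * (n C k) + (1 + n) * (n C suc k))   ≡⟨ cong (a +_) (*-distribˡ-+ (1 + n) (n C k) (n C suc k)) ⟨
  a + (1 + n) * (n C k + n C suc k)                 ≡⟨ cong (λ c → a + (1 + n) * c) (nCk+nC[k+1]≡[n+1]C[k+1] n k) ⟩
  a + (1 + n) * a                                   ∎
  where
  open ≡-Reasoning
  a = suc n C suc k
  b = suc n C (2 + k)
  expand : ∀ k a b → (2 + k) * (a + b) ≡ a + ((1 + k) * a + (2 + k) * b)
  expand = solve-∀

x+[1+n∸e]≡1+x+[n∸e] : ∀ x {n e} → e ≤ n → x + (suc n ∸ e) ≡ suc (x + (n ∸ e))
x+[1+n∸e]≡1+x+[n∸e] x {n} {e} e≤n = trans (cong (x +_) (+-∸-assoc 1 e≤n)) (+-suc x (n ∸ e))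

pascal-step : ∀ x {n e k a b} → e ≤ n → k + a ≡ e + b → a ≤ b → b ≤ 1 →
              (x + (suc n ∸ k)) C suc n + b * ((x + (n ∸ e)) C n)
                ≡ suc (x + (n ∸ e)) C suc n + a * ((x + (n ∸ e)) C n)
pascal-step x {n} {e} {k} e≤n eq z≤n z≤n =
  cong (λ m → m C suc n + 0)
       (trans (cong (λ j → x + (suc n ∸ j)) (+-cancelʳ-≡ 0 k e eq)) (x+[1+n∸e]≡1+x+[n∸e] x e≤n))
pascal-step x {n} {e} {k} e≤n eq (s≤s z≤n) (s≤s z≤n) =
  cong (λ m → m C suc n + 1 * ((x + (n ∸ e)) C n))
       (trans (cong (λ j → x + (suc n ∸ j)) (+-cancelʳ-≡ 1 k e eq)) (x+[1+n∸e]≡1+x+[n∸e] x e≤n))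
pascal-step x {n} {e} {k} e≤n eq z≤n (s≤s z≤n) = begin
  (x + (suc n ∸ k)) C suc n + 1 * (N C n)   ≡⟨ cong (λ j → (x + (suc n ∸ j)) C suc n + 1 * (N C n)) k≡1+e ⟩
  N C suc n + (N C n + 0)                   ≡⟨ cong (N C suc n +_) (+-identityʳ (N C n)) ⟩
  N C suc n + N C n                         ≡⟨ +-comm (N C suc n) (N C n) ⟩
  N C n + N C suc n                         ≡⟨ nCk+nC[k+1]≡[n+1]C[k+1] N n ⟩
  suc N C suc n                             ≡⟨ +-identityʳ (suc N C suc n) ⟨
  suc N C suc n + 0 * (N C n)               ∎
  where
  open ≡-Reasoning
  N = x + (n ∸ e)
  k≡1+e : k ≡ suc e
  k≡1+e = trans (sym (+-identityʳ k)) (trans eq (+-comm e 1))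

-- Permutations as injective vectors

vecsOver-complete : ∀ {A : Set} {xs : List A} → (∀ x → x ∈ xs) → ∀ {k} (v : Vec A k) → v ∈ vecsOver xs k
vecsOver-complete ∈xs Vec.[]      = here refl
vecsOver-complete ∈xs (x Vec.∷ v) =
  ∈-concat⁺′ (∈-map⁺ (x Vec.∷_) (vecsOver-complete ∈xs v)) (∈-map⁺ _ (∈xs x))

vecsOver-unique : ∀ {A : Set} {xs : List A} → Unique xs → ∀ k → Unique (vecsOver xs k)
vecsOver-unique u zero    = All.[] ∷ []
vecsOver-unique {xs = xs} u (suc k) =
  Uniqueₚ.concat⁺ (Allₚ.map⁺ (All.universal (λ _ → Uniqueₚ.map⁺ Vecₚ.∷-injectiveʳ (vecsOver-unique u k)) xs))
                  (AllPairsₚ.map⁺ (AllPairs.map disjoint u))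
  where
  disjoint : ∀ {x y} → x ≢ y → Disjoint (map (x Vec.∷_) (vecsOver xs k)) (map (y Vec.∷_) (vecsOver xs k))
  disjoint x≢y (v∈x∷ , v∈y∷) with ∈-map⁻ _ v∈x∷ | ∈-map⁻ _ v∈y∷
  ... | _ , _ , refl | _ , _ , eq = x≢y (Vecₚ.∷-injectiveˡ eq)

toList≡tabulate∘lookup : ∀ {A : Set} {n} (xs : Vec A n) → toList xs ≡ List.tabulate (lookup xs)
toList≡tabulate∘lookup Vec.[]       = refl
toList≡tabulate∘lookup (x Vec.∷ xs) = cong (x ∷_) (toList≡tabulate∘lookup xs)

tabulate-unique⇒injective : ∀ {A : Set} {n} {f : Fin n → A} → Unique (List.tabulate f) → Injective _≡_ _≡_ f
tabulate-unique⇒injective (_   ∷ _) {Fin.zero}  {Fin.zero}  _  = refl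
tabulate-unique⇒injective (f₀∉ ∷ _) {Fin.zero}  {Fin.suc j} eq = contradiction eq (Allₚ.tabulate⁻ f₀∉ j)
tabulate-unique⇒injective (f₀∉ ∷ _) {Fin.suc i} {Fin.zero}  eq = contradiction (sym eq) (Allₚ.tabulate⁻ f₀∉ i)
tabulate-unique⇒injective (_   ∷ u) {Fin.suc i} {Fin.suc j} eq = cong Fin.suc (tabulate-unique⇒injective u eq)

∈perms⇒injective : ∀ {n} {σ : Vec (Fin n) n} → σ ∈ perms n → Injective _≡_ _≡_ (lookup σ)
∈perms⇒injective {n} {σ} σ∈ = tabulate-unique⇒injective
  (subst Unique (toList≡tabulate∘lookup σ) (proj₂ (∈-filter⁻ isPerm? {xs = allMaps n} σ∈)))

injective⇒∈perms : ∀ {n} {σ : Vec (Fin n) n} → Injective _≡_ _≡_ (lookup σ) → σ ∈ perms n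
injective⇒∈perms {σ = σ} inj = ∈-filter⁺ isPerm? (vecsOver-complete ∈-allFin σ)
  (subst Unique (sym (toList≡tabulate∘lookup σ)) (Uniqueₚ.tabulate⁺ inj))

perms-unique : ∀ n → Unique (perms n)
perms-unique n = Uniqueₚ.filter⁺ isPerm? (vecsOver-unique (Uniqueₚ.allFin⁺ n) n)

injective⇒hits-top : ∀ {n} {f : Fin (suc n) → Fin (suc n)} → Injective _≡_ _≡_ f → ∃ λ q → f q ≡ fromℕ n
injective⇒hits-top {n} inj with Finₚ.injective⇒existsPivot inj (fromℕ n)
... | q , _ , top≤fq = q , Finₚ.≤-antisym (Finₚ.≤fromℕ _) top≤fq

≗-lookup⇒≡ : ∀ {A : Set} {n} {xs ys : Vec A n} → (∀ i → lookup xs i ≡ lookup ys i) → xs ≡ ys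
≗-lookup⇒≡ {xs = xs} {ys} eq =
  trans (sym (Vecₚ.tabulate∘lookup xs)) (trans (Vecₚ.tabulate-cong eq) (Vecₚ.tabulate∘lookup ys))

lookup-∷ʳ-inject₁ : ∀ {A : Set} {n} (xs : Vec A n) x i → lookup (xs ∷ʳ x) (inject₁ i) ≡ lookup xs i
lookup-∷ʳ-inject₁ (y Vec.∷ xs) x Fin.zero    = refl
lookup-∷ʳ-inject₁ (y Vec.∷ xs) x (Fin.suc i) = lookup-∷ʳ-inject₁ xs x i

lookup-∷ʳ-fromℕ : ∀ {A : Set} {n} (xs : Vec A n) x → lookup (xs ∷ʳ x) (fromℕ n) ≡ x
lookup-∷ʳ-fromℕ Vec.[]       x = refl
lookup-∷ʳ-fromℕ (y Vec.∷ xs) x = lookup-∷ʳ-fromℕ xs x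

transpose-matchˡ : ∀ {n} (i j : Fin n) → transpose i j i ≡ j
transpose-matchˡ i j rewrite dec-true (i Finₚ.≟ i) refl = refl

transpose-other : ∀ {n} {i j k : Fin n} → k ≢ i → k ≢ j → transpose i j k ≡ k
transpose-other {i = i} {j} {k} k≢i k≢j rewrite dec-false (k Finₚ.≟ i) k≢i | dec-false (k Finₚ.≟ j) k≢j = refl

transpose-injective : ∀ {n} (i j : Fin n) → Injective _≡_ _≡_ (transpose i j)
transpose-injective i j eq = trans (sym (transpose-inverse j i)) (trans (cong (transpose j i) eq) (transpose-inverse j i))

-- Inserting the new point n

extend : ∀ {n} → Vec (Fin n) n → Vec (Fin (suc n)) (suc n)
extend {n} τ = Vec.map inject₁ τ ∷ʳ fromℕ n

module _ {n} (τ : Vec (Fin n) n) where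

  lookup-extend-inject₁ : ∀ i → lookup (extend τ) (inject₁ i) ≡ inject₁ (lookup τ i)
  lookup-extend-inject₁ i =
    trans (lookup-∷ʳ-inject₁ (Vec.map inject₁ τ) (fromℕ n) i) (Vecₚ.lookup-map i inject₁ τ)

  lookup-extend-fromℕ : lookup (extend τ) (fromℕ n) ≡ fromℕ n
  lookup-extend-fromℕ = lookup-∷ʳ-fromℕ (Vec.map inject₁ τ) (fromℕ n)

  extend-hits-top⇒top : ∀ {k} → lookup (extend τ) k ≡ fromℕ n → k ≡ fromℕ n
  extend-hits-top⇒top {k} eq with view k
  ... | ‵fromℕ          = refl
  ... | ‵inj₁ {i = i} _ = contradiction (trans (sym eq) (lookup-extend-inject₁ i)) Finₚ.fromℕ≢inject₁

  injective-extend : Injective _≡_ _≡_ (lookup τ) → Injective _≡_ _≡_ (lookup (extend τ))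
  injective-extend inj {a} {b} eq with view a | view b
  ... | ‵fromℕ          | _               = sym (extend-hits-top⇒top (trans (sym eq) lookup-extend-fromℕ))
  ... | ‵inj₁ _         | ‵fromℕ          = extend-hits-top⇒top (trans eq lookup-extend-fromℕ)
  ... | ‵inj₁ {i = i} _ | ‵inj₁ {i = j} _ = cong inject₁ (inj (Finₚ.inject₁-injective
    (trans (sym (lookup-extend-inject₁ i)) (trans eq (lookup-extend-inject₁ j)))))

extend-injective : ∀ {n} {τ τ′ : Vec (Fin n) n} →
                   (∀ k → lookup (extend τ) k ≡ lookup (extend τ′) k) → τ ≡ τ′
extend-injective {τ = τ} {τ′} eq = ≗-lookup⇒≡ λ i → Finₚ.inject₁-injective
  (trans (sym (lookup-extend-inject₁ τ i)) (trans (eq (inject₁ i)) (lookup-extend-inject₁ τ′ i)))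

fixes-top⇒extend : ∀ {n} (ρ : Fin (suc n) → Fin (suc n)) → Injective _≡_ _≡_ ρ → ρ (fromℕ n) ≡ fromℕ n →
                   ∃ λ τ → Injective _≡_ _≡_ (lookup τ) × (∀ k → lookup (extend τ) k ≡ ρ k)
fixes-top⇒extend {n} ρ ρ-inj ρ-top = τ , τ-inj , extend-τ
  where
  ρ-inject₁≢top : ∀ j → n ≢ toℕ (ρ (inject₁ j))
  ρ-inject₁≢top j eq = Finₚ.fromℕ≢inject₁ (sym (ρ-inj (trans ρ-inject₁≡top (sym ρ-top))))
    where ρ-inject₁≡top = Finₚ.toℕ-injective (trans (sym eq) (sym (Finₚ.toℕ-fromℕ n)))
  τ : Vec (Fin n) n
  τ = tabulate (λ j → lower₁ (ρ (inject₁ j)) (ρ-inject₁≢top j))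
  inject₁-τ : ∀ j → inject₁ (lookup τ j) ≡ ρ (inject₁ j)
  inject₁-τ j = trans (cong inject₁ (Vecₚ.lookup∘tabulate _ j)) (Finₚ.inject₁-lower₁ _ (ρ-inject₁≢top j))
  τ-inj : Injective _≡_ _≡_ (lookup τ)
  τ-inj {i} {j} eq = Finₚ.inject₁-injective
    (ρ-inj (trans (sym (inject₁-τ i)) (trans (cong inject₁ eq) (inject₁-τ j))))
  extend-τ : ∀ k → lookup (extend τ) k ≡ ρ k
  extend-τ k with view k
  ... | ‵fromℕ          = trans (lookup-extend-fromℕ τ) (sym ρ-top)
  ... | ‵inj₁ {i = j} _ = trans (lookup-extend-inject₁ τ j) (inject₁-τ j)

insertAt : ∀ {n} → Vec (Fin n) n → Fin (suc n) → Vec (Fin (suc n)) (suc n)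
insertAt {n} τ q = tabulate (lookup (extend τ) ∘ transpose q (fromℕ n))

module _ {n} (τ : Vec (Fin n) n) (q : Fin (suc n)) where

  lookup-insertAt : ∀ k → lookup (insertAt τ q) k ≡ lookup (extend τ) (transpose q (fromℕ n) k)
  lookup-insertAt = Vecₚ.lookup∘tabulate _

  lookup-insertAt-q : lookup (insertAt τ q) q ≡ fromℕ n
  lookup-insertAt-q =
    trans (lookup-insertAt q) (trans (cong (lookup (extend τ)) (transpose-matchˡ q (fromℕ n))) (lookup-extend-fromℕ τ))

  insertAt-hits-top⇒q : ∀ {k} → lookup (insertAt τ q) k ≡ fromℕ n → k ≡ q
  insertAt-hits-top⇒q {k} eq = transpose-injective q (fromℕ n)
    (trans (extend-hits-top⇒top τ (trans (sym (lookup-insertAt k)) eq)) (sym (transpose-matchˡ q (fromℕ n))))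

  injective-insertAt : Injective _≡_ _≡_ (lookup τ) → Injective _≡_ _≡_ (lookup (insertAt τ q))
  injective-insertAt inj {a} {b} eq = transpose-injective q (fromℕ n)
    (injective-extend τ inj (trans (sym (lookup-insertAt a)) (trans eq (lookup-insertAt b))))

insertAt-injective : ∀ {n} (τ τ′ : Vec (Fin n) n) q q′ →
                     insertAt τ q ≡ insertAt τ′ q′ → τ ≡ τ′ × q ≡ q′
insertAt-injective {n} τ τ′ q q′ eq
  with insertAt-hits-top⇒q τ′ q′ {q} (trans (cong (λ σ → lookup σ q) (sym eq)) (lookup-insertAt-q τ q))
... | refl = extend-injective extend-≗ , refl
  where
  extend-≗ : ∀ k → lookup (extend τ) k ≡ lookup (extend τ′) k
  extend-≗ k = begin
    lookup (extend τ) k                          ≡⟨ cong (lookup (extend τ)) (transpose-inverse q (fromℕ n)) ⟨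
    lookup (extend τ) (transpose q (fromℕ n) k′)  ≡⟨ lookup-insertAt τ q k′ ⟨
    lookup (insertAt τ q) k′                     ≡⟨ cong (λ σ → lookup σ k′) eq ⟩
    lookup (insertAt τ′ q) k′                    ≡⟨ lookup-insertAt τ′ q k′ ⟩
    lookup (extend τ′) (transpose q (fromℕ n) k′) ≡⟨ cong (lookup (extend τ′)) (transpose-inverse q (fromℕ n)) ⟩
    lookup (extend τ′) k                         ∎
    where
    open ≡-Reasoning
    k′ = transpose (fromℕ n) q k

insertAt-surjective : ∀ {n} {σ : Vec (Fin (suc n)) (suc n)} → Injective _≡_ _≡_ (lookup σ) →
                      ∃₂ λ τ q → Injective _≡_ _≡_ (lookup τ) × σ ≡ insertAt τ q
insertAt-surjective {n} {σ} σ-inj with injective⇒hits-top σ-inj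
... | q , σq≡top with fixes-top⇒extend (lookup σ ∘ transpose (fromℕ n) q)
                                       (λ eq → transpose-injective (fromℕ n) q (σ-inj eq))
                                       (trans (cong (lookup σ) (transpose-matchˡ (fromℕ n) q)) σq≡top)
...   | τ , τ-inj , extend-τ = τ , q , τ-inj , ≗-lookup⇒≡ λ k → sym (begin
  lookup (insertAt τ q) k                                     ≡⟨ lookup-insertAt τ q k ⟩
  lookup (extend τ) (transpose q (fromℕ n) k)                 ≡⟨ extend-τ _ ⟩
  lookup σ (transpose (fromℕ n) q (transpose q (fromℕ n) k))  ≡⟨ cong (lookup σ) (transpose-inverse (fromℕ n) q) ⟩
  lookup σ k                                                  ∎)
  where open ≡-Reasoning

insertions : ∀ {n} → Vec (Fin n) n → List (Vec (Fin (suc n)) (suc n))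
insertions τ = List.tabulate (insertAt τ)

perms-suc↭ : ∀ n → perms (suc n) ↭ concatMap insertions (perms n)
perms-suc↭ n = ∼bag⇒↭ (unique∧set⇒bag (perms-unique (suc n)) unique (mk⇔ to from))
  where
  disjoint : ∀ {τ τ′} → τ ≢ τ′ → Disjoint (insertions τ) (insertions τ′)
  disjoint {τ} {τ′} τ≢τ′ (σ∈ , σ∈′)
    with ∈-tabulate⁻ {f = insertAt τ} σ∈ | ∈-tabulate⁻ {f = insertAt τ′} σ∈′
  ... | q , refl | q′ , eq = τ≢τ′ (proj₁ (insertAt-injective τ τ′ q q′ eq))
  unique : Unique (concatMap insertions (perms n))
  unique = Uniqueₚ.concat⁺ (Allₚ.map⁺ (All.universal insertions-unique (perms n)))
                           (AllPairsₚ.map⁺ (AllPairs.map disjoint (perms-unique n)))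
    where
    insertions-unique : ∀ τ → Unique (insertions τ)
    insertions-unique τ =
      Uniqueₚ.tabulate⁺ {f = insertAt τ} (λ {q} {q′} eq → proj₂ (insertAt-injective τ τ q q′ eq))
  to : ∀ {σ} → σ ∈ perms (suc n) → σ ∈ concatMap insertions (perms n)
  to {σ} σ∈ with insertAt-surjective {σ = σ} (∈perms⇒injective σ∈)
  ... | τ , q , τ-inj , refl =
    ∈-concat⁺′ (∈-tabulate⁺ {f = insertAt τ} q) (∈-map⁺ insertions (injective⇒∈perms {σ = τ} τ-inj))
  from : ∀ {σ} → σ ∈ concatMap insertions (perms n) → σ ∈ perms (suc n)
  from σ∈ with ∈-concat⁻′ (map insertions (perms n)) σ∈
  ... | _ , σ∈ins , ins∈ with ∈-map⁻ insertions ins∈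
  ...   | τ , τ∈ , refl with ∈-tabulate⁻ {f = insertAt τ} σ∈ins
  ...     | q , refl = injective⇒∈perms (injective-insertAt τ q (∈perms⇒injective τ∈))

sum-perms-suc : ∀ n (g : Vec (Fin (suc n)) (suc n) → ℕ) →
                sum (map g (perms (suc n))) ≡ sum (map (λ τ → ∑[ q < suc n ] g (insertAt τ q)) (perms n))
sum-perms-suc n g = begin
  sum (map g (perms (suc n)))                                  ≡⟨ sum-↭ (↭ₚ.map⁺ g (perms-suc↭ n)) ⟩
  sum (map g (concatMap insertions (perms n)))                 ≡⟨ sum-concatMap g insertions (perms n) ⟩
  sum (map (λ τ → sum (map g (insertions τ))) (perms n))       ≡⟨ cong sum (Listₚ.map-cong per-τ (perms n)) ⟩
  sum (map (λ τ → ∑[ q < suc n ] g (insertAt τ q)) (perms n))  ∎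
  where
  open ≡-Reasoning
  per-τ : ∀ τ → sum (map g (insertions τ)) ≡ ∑[ q < suc n ] g (insertAt τ q)
  per-τ τ = trans (cong sum (Listₚ.map-tabulate (insertAt τ) g)) (sum-tabulate (g ∘ insertAt τ))

-- Counting r-excedances

exc : ∀ {n} → ℕ → Vec (Fin n) n → ℕ
exc r σ = ∣ rExc r σ ∣

exc≡∑ : ∀ {n} r (σ : Vec (Fin n) n) → exc r σ ≡ ∑[ i < n ] ⟦ toℕ i + r ≤ toℕ (lookup σ i) ⟧
exc≡∑ r σ = ∣tabulate∣≡∑ (λ i → does (toℕ i + r ≤? toℕ (lookup σ i)))

exc≤n∸r : ∀ {n} r (σ : Vec (Fin n) n) → exc r σ ≤ n ∸ r
exc≤n∸r {n} r σ = begin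
  exc r σ                                       ≡⟨ exc≡∑ r σ ⟩
  ∑[ i < n ] ⟦ toℕ i + r ≤ toℕ (lookup σ i) ⟧   ≤⟨ ∑-mono-≤ (λ i → ⟦⟧-mono (λ le → ≤-trans (s≤s le) (σ<n i))) ⟩
  ∑[ i < n ] ⟦ suc (toℕ i + r) ≤ n ⟧            ≡⟨ ∑[i<n]⟦i+t<n⟧≡n∸t n r ⟩
  n ∸ r                                         ∎
  where
  open ≤-Reasoning
  σ<n : ∀ i → toℕ (lookup σ i) < n
  σ<n i = Finₚ.toℕ<n (lookup σ i)

no-exceedance-at-top : ∀ {n} r → 1 ≤ r → (v : Fin (suc n)) → ⟦ toℕ (fromℕ n) + r ≤ toℕ v ⟧ ≡ 0
no-exceedance-at-top {n} r 1≤r v = ⟦⟧-no (begin-strict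
  toℕ v               <⟨ Finₚ.toℕ<n v ⟩
  suc n               ≡⟨ +-comm 1 n ⟩
  n + 1               ≤⟨ +-monoʳ-≤ n 1≤r ⟩
  n + r               ≡⟨ cong (_+ r) (Finₚ.toℕ-fromℕ n) ⟨
  toℕ (fromℕ n) + r   ∎)
  where open ≤-Reasoning

exc-extend : ∀ {n} r → 1 ≤ r → (τ : Vec (Fin n) n) → exc r (extend τ) ≡ exc r τ
exc-extend {n} r 1≤r τ = begin
  exc r (extend τ)
    ≡⟨ trans (exc≡∑ r (extend τ)) (sum-init-last (λ k → ⟦ toℕ k + r ≤ toℕ (lookup (extend τ) k) ⟧)) ⟩
  ∑[ i < n ] ⟦ toℕ (inject₁ i) + r ≤ toℕ (lookup (extend τ) (inject₁ i)) ⟧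
    + ⟦ toℕ (fromℕ n) + r ≤ toℕ (lookup (extend τ) (fromℕ n)) ⟧
    ≡⟨ cong₂ _+_ (∑-cong {n} λ i → cong₂ (λ a b → ⟦ a + r ≤ b ⟧) (Finₚ.toℕ-inject₁ i)
                                    (trans (cong toℕ (lookup-extend-inject₁ τ i)) (Finₚ.toℕ-inject₁ (lookup τ i))))
                 (no-exceedance-at-top r 1≤r (lookup (extend τ) (fromℕ n))) ⟩
  ∑[ i < n ] ⟦ toℕ i + r ≤ toℕ (lookup τ i) ⟧ + 0
    ≡⟨ trans (+-identityʳ _) (sym (exc≡∑ r τ)) ⟩
  exc r τ ∎
  where open ≡-Reasoning

exc-insertAt : ∀ {n} r → 1 ≤ r → (τ : Vec (Fin n) n) (q : Fin (suc n)) →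
               exc r (insertAt τ q) + ⟦ toℕ q + r ≤ toℕ (lookup (extend τ) q) ⟧
                 ≡ exc r τ + ⟦ toℕ q + r ≤ n ⟧
exc-insertAt {n} r 1≤r τ q = begin
  exc r (insertAt τ q) + g q
    ≡⟨ cong (_+ g q) (exc≡∑ r (insertAt τ q)) ⟩
  ∑ f + g q
    ≡⟨ ∑-update f g q f≗g ⟩
  ∑ g + f q
    ≡⟨ cong₂ _+_ (trans (sym (exc≡∑ r (extend τ))) (exc-extend r 1≤r τ))
                 (cong (λ v → ⟦ toℕ q + r ≤ toℕ v ⟧) (lookup-insertAt-q τ q)) ⟩
  exc r τ + ⟦ toℕ q + r ≤ toℕ (fromℕ n) ⟧
    ≡⟨ cong (λ m → exc r τ + ⟦ toℕ q + r ≤ m ⟧) (Finₚ.toℕ-fromℕ n) ⟩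
  exc r τ + ⟦ toℕ q + r ≤ n ⟧ ∎
  where
  open ≡-Reasoning
  f g : Fin (suc n) → ℕ
  f k = ⟦ toℕ k + r ≤ toℕ (lookup (insertAt τ q) k) ⟧
  g k = ⟦ toℕ k + r ≤ toℕ (lookup (extend τ) k) ⟧
  f≗g : ∀ k → k ≢ q → f k ≡ g k
  f≗g k k≢q with k Finₚ.≟ fromℕ n
  ... | yes refl  = trans (no-exceedance-at-top r 1≤r (lookup (insertAt τ q) k))
                          (sym (no-exceedance-at-top r 1≤r (lookup (extend τ) k)))
  ... | no  k≢top = cong (λ v → ⟦ toℕ k + r ≤ toℕ v ⟧)
                         (trans (lookup-insertAt τ q k) (cong (lookup (extend τ)) (transpose-other k≢q k≢top)))

-- The product formula

weight : ∀ {n} → ℕ → ℕ → Vec (Fin n) n → ℕ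
weight {n} x r σ = (x + (n ∸ exc r σ)) C n

∑-insertAt-weight : ∀ x r → 1 ≤ r → ∀ {n} (τ : Vec (Fin n) n) →
                    ∑[ q < suc n ] weight x r (insertAt τ q) ≡ (x + r ⊓ suc n) * weight x r τ
∑-insertAt-weight x r 1≤r {n} τ = +-cancelʳ-≡ ((suc n ∸ r) * P) _ _ (begin
  ∑ g + (suc n ∸ r) * P                          ≡⟨ cong (λ c → ∑ g + c * P) ∑b ⟨
  ∑ g + ∑ b * P                                  ≡⟨ cong (∑ g +_) (*-distribʳ-sum P b) ⟩
  ∑ g + ∑[ q < suc n ] (b q * P)                 ≡⟨ ∑-distrib-+ g (λ q → b q * P) ⟨
  ∑[ q < suc n ] (g q + b q * P)                 ≡⟨ ∑-cong {suc n} step ⟩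
  ∑[ q < suc n ] (R + a q * P)                   ≡⟨ ∑-distrib-+ (λ _ → R) (λ q → a q * P) ⟩
  ∑[ q < suc n ] R + ∑[ q < suc n ] (a q * P)    ≡⟨ cong₂ _+_ (∑-const (suc n) R) (sym (*-distribʳ-sum P a)) ⟩
  suc n * R + ∑ a * P                            ≡⟨ cong₂ _+_ ([1+k]*[1+n]C[1+k]≡[1+n]*nCk N n) (cong (_* P) ∑a) ⟩
  suc N * P + e * P                              ≡⟨ *-distribʳ-+ P (suc N) e ⟨
  (suc N + e) * P                                ≡⟨ cong (_* P) 1+N+e≡x+r⊓[1+n]+[1+n∸r] ⟩
  (x + r ⊓ suc n + (suc n ∸ r)) * P              ≡⟨ *-distribʳ-+ P (x + r ⊓ suc n) (suc n ∸ r) ⟩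
  (x + r ⊓ suc n) * P + (suc n ∸ r) * P          ∎)
  where
  open ≡-Reasoning
  e = exc r τ
  N = x + (n ∸ e)
  P = N C n
  R = suc N C suc n
  g a b : Fin (suc n) → ℕ
  g q = weight x r (insertAt τ q)
  a q = ⟦ toℕ q + r ≤ toℕ (lookup (extend τ) q) ⟧
  b q = ⟦ toℕ q + r ≤ n ⟧
  e≤n : e ≤ n
  e≤n = ≤-trans (exc≤n∸r r τ) (m∸n≤m n r)
  a≤b : ∀ q → a q ≤ b q
  a≤b q = ⟦⟧-mono {toℕ q + r} {c = toℕ q + r} (λ le → ≤-trans le (Finₚ.toℕ≤pred[n] (lookup (extend τ) q)))
  step : ∀ q → g q + b q * P ≡ R + a q * P
  step q = pascal-step x {a = a q} {b q} e≤n (exc-insertAt r 1≤r τ q) (a≤b q) (⟦⟧≤1 (toℕ q + r) n)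
  ∑a : ∑ a ≡ e
  ∑a = trans (sym (exc≡∑ r (extend τ))) (exc-extend r 1≤r τ)
  ∑b : ∑ b ≡ suc n ∸ r
  ∑b = trans (∑-cong {suc n} (λ q → sym (⟦⟧-cong-suc (toℕ q + r) n))) (∑[i<n]⟦i+t<n⟧≡n∸t (suc n) r)
  1+N+e≡x+r⊓[1+n]+[1+n∸r] : suc N + e ≡ x + r ⊓ suc n + (suc n ∸ r)
  1+N+e≡x+r⊓[1+n]+[1+n∸r] = begin
    suc (x + (n ∸ e) + e)           ≡⟨ cong suc (+-assoc x (n ∸ e) e) ⟩
    suc (x + (n ∸ e + e))           ≡⟨ cong (λ m → suc (x + m)) (m∸n+n≡m e≤n) ⟩
    suc (x + n)                     ≡⟨ +-suc x n ⟨
    x + suc n                       ≡⟨ cong (x +_) (m⊓n+n∸m≡n r (suc n)) ⟨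
    x + (r ⊓ suc n + (suc n ∸ r))   ≡⟨ +-assoc x (r ⊓ suc n) (suc n ∸ r) ⟨
    x + r ⊓ suc n + (suc n ∸ r)     ∎

minProduct : ℕ → ℕ → ℕ → ℕ
minProduct x r zero    = 1
minProduct x r (suc n) = (x + r ⊓ suc n) * minProduct x r n

∑-perms-weight : ∀ x r → 1 ≤ r → ∀ n → sum (map (weight x r) (perms n)) ≡ minProduct x r n
∑-perms-weight x r 1≤r zero    = refl
∑-perms-weight x r 1≤r (suc n) = begin
  sum (map (weight x r) (perms (suc n)))
    ≡⟨ sum-perms-suc n (weight x r) ⟩
  sum (map (λ τ → ∑[ q < suc n ] weight x r (insertAt τ q)) (perms n))
    ≡⟨ cong sum (Listₚ.map-cong (∑-insertAt-weight x r 1≤r) (perms n)) ⟩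
  sum (map (λ τ → (x + r ⊓ suc n) * weight x r τ) (perms n))
    ≡⟨ sum-map-*ˡ (x + r ⊓ suc n) (weight x r) (perms n) ⟩
  (x + r ⊓ suc n) * sum (map (weight x r) (perms n))
    ≡⟨ cong ((x + r ⊓ suc n) *_) (∑-perms-weight x r 1≤r n) ⟩
  minProduct x r (suc n) ∎
  where open ≡-Reasoning

minProduct-below : ∀ x r i → i ≤ r → minProduct x r i * x ! ≡ (x + i) !
minProduct-below x r zero    _   = trans (+-identityʳ (x !)) (cong _! (sym (+-identityʳ x)))
minProduct-below x r (suc i) i<r = begin
  (x + r ⊓ suc i) * minProduct x r i * x !    ≡⟨ *-assoc (x + r ⊓ suc i) _ _ ⟩
  (x + r ⊓ suc i) * (minProduct x r i * x !)  ≡⟨ cong₂ (λ a b → (x + a) * b) (m≥n⇒m⊓n≡n i<r)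
                                                                             (minProduct-below x r i (<⇒≤ i<r)) ⟩
  (x + suc i) * (x + i) !                     ≡⟨ cong (_* (x + i) !) (+-suc x i) ⟩
  suc (x + i) * (x + i) !                     ≡⟨ cong _! (+-suc x i) ⟨
  (x + suc i) !                               ∎
  where open ≡-Reasoning

minProduct-above : ∀ x r t → minProduct x r (t + r) ≡ (x + r) ^ t * minProduct x r r
minProduct-above x r zero    = sym (+-identityʳ (minProduct x r r))
minProduct-above x r (suc t) = begin
  (x + r ⊓ suc (t + r)) * minProduct x r (t + r)  ≡⟨ cong₂ (λ a b → (x + a) * b) (m≤n⇒m⊓n≡m (m≤n+m r (suc t)))
                                                                                 (minProduct-above x r t) ⟩
  (x + r) * ((x + r) ^ t * minProduct x r r)      ≡⟨ *-assoc (x + r) _ _ ⟨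
  (x + r) ^ suc t * minProduct x r r              ∎
  where open ≡-Reasoning

minProduct-closed-form : ∀ {m r n} → r ≤ m → r ≤ n →
                         minProduct (m ∸ r) r n ≡ m ^ (n ∸ r) * (m ! / (m ∸ r) !) {{(m ∸ r) !≢0}}
minProduct-closed-form {m} {r} {n} r≤m r≤n = begin
  minProduct x r n                      ≡⟨ cong (minProduct x r) (m∸n+n≡m r≤n) ⟨
  minProduct x r (n ∸ r + r)            ≡⟨ minProduct-above x r (n ∸ r) ⟩
  (x + r) ^ (n ∸ r) * minProduct x r r  ≡⟨ cong₂ (λ a b → a ^ (n ∸ r) * b) x+r≡m falling ⟩
  m ^ (n ∸ r) * (m ! / x !) {{x !≢0}}   ∎
  where
  open ≡-Reasoning
  x = m ∸ r
  x+r≡m : x + r ≡ m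
  x+r≡m = m∸n+n≡m r≤m
  falling : minProduct x r r ≡ (m ! / x !) {{x !≢0}}
  falling = begin
    minProduct x r r                          ≡⟨ m*n/n≡m (minProduct x r r) (x !) {{x !≢0}} ⟨
    (minProduct x r r * x ! / x !) {{x !≢0}}  ≡⟨ cong (λ a → (a / x !) {{x !≢0}}) (minProduct-below x r r ≤-refl) ⟩
    ((x + r) ! / x !) {{x !≢0}}               ≡⟨ cong (λ a → (a ! / x !) {{x !≢0}}) x+r≡m ⟩
    (m ! / x !) {{x !≢0}}                     ∎

-- The hypothesis 1 ≤ n is implied by 1 ≤ r ≤ n.
mainTheorem14 : (n r m : ℕ) → 1 ≤ n → 1 ≤ r → r ≤ n → r ≤ m →
    sumTo (n ∸ r) (λ s → rA r n (n ∸ r ∸ s) * ((m + s) C n))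
    ≡ m ^ (n ∸ r) * (_/_ (m !) ((m ∸ r) !) {{(m ∸ r) !≢0}})
mainTheorem14 n r m _ 1≤r r≤n r≤m = begin
  sumTo (n ∸ r) (λ s → rA r n (n ∸ r ∸ s) * ((m + s) C n))
    ≡⟨ sumTo-count (perms n) (exc r) (n ∸ r) (λ s → (m + s) C n) (exc≤n∸r r) ⟩
  sum (map (λ σ → (m + (n ∸ r ∸ exc r σ)) C n) (perms n))
    ≡⟨ cong sum (Listₚ.map-cong (λ σ → cong (_C n) (shift (exc≤n∸r r σ))) (perms n)) ⟩
  sum (map (weight (m ∸ r) r) (perms n))
    ≡⟨ ∑-perms-weight (m ∸ r) r 1≤r n ⟩
  minProduct (m ∸ r) r n
    ≡⟨ minProduct-closed-form r≤m r≤n ⟩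
  m ^ (n ∸ r) * (_/_ (m !) ((m ∸ r) !) {{(m ∸ r) !≢0}}) ∎
  where
  open ≡-Reasoning
  shift : ∀ {e} → e ≤ n ∸ r → m + (n ∸ r ∸ e) ≡ m ∸ r + (n ∸ e)
  shift {e} e≤n∸r = begin
    m + (n ∸ r ∸ e)            ≡⟨ cong (_+ (n ∸ r ∸ e)) (m∸n+n≡m r≤m) ⟨
    m ∸ r + r + (n ∸ r ∸ e)    ≡⟨ +-assoc (m ∸ r) r _ ⟩
    m ∸ r + (r + (n ∸ r ∸ e))  ≡⟨ cong (m ∸ r +_) (+-∸-assoc r e≤n∸r) ⟨
    m ∸ r + (r + (n ∸ r) ∸ e)  ≡⟨ cong (λ a → m ∸ r + (a ∸ e)) (m+[n∸m]≡n r≤n) ⟩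
    m ∸ r + (n ∸ e)            ∎
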